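{- Let $\Gamma$ be a connected simple graph on $[n]$ and let $M\subseteq[n]$ be a subset of maximal cardinality such that the induced subgraph $\Gamma|_M$ is isomorphic to the path graph $L_{|M|}$. Then for all $k\ge|M|$ the polytopes $Q_{\Gamma,k}$ and $Q_{\Gamma,|M|-1}$ are normally equivalent, i.e. the normal fan of $Q_{\Gamma,k}$ coincides with the normal fan of $Q_{\Gamma,|M|-1}$.
   Context: $L_r$ is the path graph on $[r]$ with edges $\{i,i+1\}$. For $S\subseteq[n]$, $\Delta_S=\mathrm{conv}\{e_s:s\in S\}\subset\mathbb{R}^n$. For $j\in\mathbb{N}$, the $j$-graph polytope is the Minkowski sum $Q_{\Gamma,j}=\sum_{S\subseteq[n],\,|S|\le j+1,\,\Gamma|_S\text{ connected}}\Delta_S$.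
   Formalization: The polytopes $Q_{\Gamma,k}$ and $Q_{\Gamma,|M|-1}$ and their normal fans are taken in ℚ^n rather than ℝ^n: points and the functionals defining faces and normal cones have rational coordinates. -}

module Defs where

open import Data.Nat as ℕ using (ℕ; zero; suc)
open import Data.Fin using (Fin; toℕ)
open import Data.Fin.Subset using (Subset; _∈_; _∉_; ∣_∣; Nonempty)
open import Data.Bool using (Bool; true; false)
open import Data.Vec using (Vec; []; _∷_)
open import Data.List using (List; []; _∷_; _++_; map)
open import Data.Rational using (ℚ; 0ℚ; 1ℚ; _+_; _*_; _≤_)
open import Data.Product using (Σ; _×_; ∃; ∃-syntax)
open import Data.Sum using (_⊎_)
open import Relation.Binary.PropositionalEquality using (_≡_)
open import Relation.Nullary using (¬_)
open import Function.Definitions using (Injective)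

record SimpleGraph (n : ℕ) : Set where
  field
    adj     : Fin n → Fin n → Bool
    symm    : ∀ i j → adj i j ≡ adj j i
    irrefl  : ∀ i → adj i i ≡ false
open SimpleGraph public

Adj : ∀ {n} → SimpleGraph n → Fin n → Fin n → Set
Adj Γ i j = adj Γ i j ≡ true

data ReachIn {n} (Γ : SimpleGraph n) (S : Subset n) : Fin n → Fin n → Set where
  here : ∀ {i} → i ∈ S → ReachIn Γ S i i
  step : ∀ {i k j} → i ∈ S → Adj Γ i k → ReachIn Γ S k j → ReachIn Γ S i j

InducedConnected : ∀ {n} → SimpleGraph n → Subset n → Set
InducedConnected Γ S = Nonempty S × (∀ i j → i ∈ S → j ∈ S → ReachIn Γ S i j)

full : ∀ n → Subset n
full zero = []
full (suc n) = true ∷ full n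

Connected : ∀ {n} → SimpleGraph n → Set
Connected {n} Γ = InducedConnected Γ (full n)

PathAdj : ∀ {r} → Fin r → Fin r → Set
PathAdj i j = (toℕ j ≡ suc (toℕ i)) ⊎ (toℕ i ≡ suc (toℕ j))

InducesPath : ∀ {n} → SimpleGraph n → Subset n → Set
InducesPath Γ M =
  Σ (Fin ∣ M ∣ → Fin _) λ f →
    Injective _≡_ _≡_ f
    × (∀ x → x ∈ M → ∃[ i ] f i ≡ x)
    × (∀ i → f i ∈ M)
    × (∀ i j → (Adj Γ (f i) (f j) → PathAdj i j) × (PathAdj i j → Adj Γ (f i) (f j)))

Point : ℕ → Set
Point n = Fin n → ℚ

sumFin : ∀ {n} → (Fin n → ℚ) → ℚ
sumFin {zero} f = 0ℚ
sumFin {suc n} f = f Fin.zero + sumFin (λ i → f (Fin.suc i))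

dot : ∀ {n} → Point n → Point n → ℚ
dot w x = sumFin (λ i → w i * x i)

zeroP : ∀ {n} → Point n
zeroP _ = 0ℚ

_⊕_ : ∀ {n} → Point n → Point n → Point n
(x ⊕ y) i = x i + y i

allSubsets : ∀ n → List (Subset n)
allSubsets zero = [] ∷ []
allSubsets (suc n) = map (false ∷_) (allSubsets n) ++ map (true ∷_) (allSubsets n)

sumPoints : ∀ {n} → List (Point n) → Point n
sumPoints [] = zeroP
sumPoints (x ∷ xs) = x ⊕ sumPoints xs

Polytope : ℕ → Set₁
Polytope n = Point n → Set

-- Δ_S = conv{e_s : s ∈ S}
Δ : ∀ {n} → Subset n → Polytope n
Δ S x = (∀ i → 0ℚ ≤ x i) × (∀ i → i ∉ S → x i ≡ 0ℚ) × (sumFin x ≡ 1ℚ)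

Contributes : ∀ {n} → SimpleGraph n → ℕ → Subset n → Set
Contributes Γ j S = (∣ S ∣ ℕ.≤ suc j) × InducedConnected Γ S

-- Q_{Γ,j} = Minkowski sum of Δ_S over contributing S:
-- x ∈ Q iff x = Σ_S p_S with p_S ∈ Δ_S for contributing S, p_S = 0 otherwise
Q : ∀ {n} → SimpleGraph n → ℕ → Polytope n
Q {n} Γ j x =
  Σ (Subset n → Point n) λ p →
    (∀ S → Contributes Γ j S → Δ S (p S))
    × (∀ S → ¬ Contributes Γ j S → p S ≡ zeroP)
    × (∀ i → x i ≡ sumPoints (map p (allSubsets n)) i)

face : ∀ {n} → Polytope n → Point n → Polytope n
face P w x = P x × (∀ y → P y → dot w y ≤ dot w x)

NormalCone : ∀ {n} → Polytope n → Point n → Point n → Set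
NormalCone P w u = ∀ x → face P w x → face P u x

-- every cone of the normal fan of P is a cone of the normal fan of P'
-- (every nonempty face of P is F_w(P) for some w)
FanIncluded : ∀ {n} → Polytope n → Polytope n → Set
FanIncluded {n} P P' =
  ∀ (w : Point n) → ∃[ w' ] (∀ u → (NormalCone P w u → NormalCone P' w' u)
                                  × (NormalCone P' w' u → NormalCone P w u))

NormallyEquivalent : ∀ {n} → Polytope n → Polytope n → Set
NormallyEquivalent P P' = FanIncluded P P' × FanIncluded P' P

{-# OPTIONS --safe #-}
-- A functional w is maximised on the Minkowski sum Q_{Γ,j} exactly by the sums of
-- w-maximisers of the summands Δ_S, and the w-face of Δ_S is the simplex on the
-- w-maximal vertices of S.  Hence u lies in the normal cone of the w-face of Q_{Γ,j}
-- iff every w-maximal vertex of every contributing S is also u-maximal in S.  This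
-- condition cannot get stronger beyond j = |M| - 1: if t is w-maximal in a connected
-- S and s ∈ S, a shortest path from t to s inside S is an induced path, so it has at
-- most |M| vertices and contributes already to Q_{Γ,|M|-1}; t is w-maximal on it, so
-- u s ≤ u t.
module Submission where

open import Defs
open import Data.Nat using (ℕ; _≤_; _<_; _∸_)
open import Data.Fin.Subset using (Subset; ∣_∣)

open import Data.Nat using (zero; suc; s≤s)
import Data.Nat.Properties as ℕ
open import Data.Fin using (Fin; toℕ; cast; zero; suc)
import Data.Fin
open import Data.Fin.Properties using (toℕ-cast; toℕ-injective; cast-involutive)
open import Data.Fin.Subset using (_∈_; _∉_; _⊆_; Nonempty; ⁅_⁆; _∪_; inside; outside)
  renaming (⊥ to ∅)
open import Data.Fin.Subset.Properties
  using (_∈?_; nonempty?; ∉⊥; ∣⊥∣≡0; x∈⁅x⁆; x∈⁅y⁆⇒x≡y; x∈p∪q⁺; x∈p∪q⁻; ∪-identityˡ)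
open import Data.Vec using ([]; _∷_; here; there)
open import Data.Vec.Properties using (≡-dec)
open import Data.Bool using (true)
import Data.Bool.Properties as Bool
open import Data.List using (List; []; _∷_; map; length; lookup)
open import Data.List.Membership.Propositional using () renaming (_∈_ to _∈ₗ_; _∉_ to _∉ₗ_)
open import Data.List.Membership.Propositional.Properties
  using (∈-map⁺; ∈-++⁺ˡ; ∈-++⁺ʳ; ∈-lookup)
open import Data.List.Relation.Unary.Any as Any using (Any; here; there; any?; index)
open import Data.List.Relation.Unary.Any.Properties using (lookup-index)
open import Data.List.Relation.Unary.All as All using (All; []; _∷_)
open import Data.List.Relation.Unary.All.Properties.Core using (¬Any⇒All¬)
open import Data.Rational using (ℚ; 0ℚ; 1ℚ; _+_; _*_; positive; nonNegative)
  renaming (_≤_ to _≤ℚ_; _<_ to _<ℚ_)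
open import Data.Rational.Properties
open import Algebra.Bundles using (CommutativeMonoid)
open import Algebra.Properties.CommutativeSemigroup
  (CommutativeMonoid.commutativeSemigroup +-0-commutativeMonoid) using (interchange)
open import Data.Product using (Σ-syntax; _×_; _,_; proj₁; proj₂; ∃; ∃-syntax)
open import Data.Sum using (_⊎_; inj₁; inj₂; swap)
import Data.Sum as Sum
open import Data.Empty using (⊥-elim)
open import Function using (_∘_; const)
open import Function.Bundles using (_⇔_; mk⇔; Equivalence)
open import Function.Construct.Composition using (_⇔-∘_)
open import Function.Construct.Symmetry using (⇔-sym)
open import Relation.Nullary using (¬_; Dec; yes; no)
open import Relation.Nullary.Decidable using (decidable-stable; ¬¬-excluded-middle)
open import Level using (0ℓ)
open import Relation.Unary using (Pred; Decidable)
open import Relation.Binary.PropositionalEquality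

private
  variable
    n : ℕ
    w u p x y : Point n
    S : Subset n
    t : Fin n

-- Contributes Γ j is not known to be decidable (connectivity is witnessed by walks),
-- but goals a ≤ b on ℚ are stable under double negation, so they may be proved by
-- cases on it.

≤-byCases : ∀ {A : Set} {a b : ℚ} → (Dec A → a ≤ℚ b) → a ≤ℚ b
≤-byCases f = decidable-stable (_ ≤? _) λ a≰b → ¬¬-excluded-middle (a≰b ∘ f)

¬¬-decidable : ∀ n (P : Pred (Subset n) 0ℓ) → ¬ ¬ Decidable P
¬¬-decidable zero P ¬dec = ¬¬-excluded-middle λ P[]? → ¬dec λ { [] → P[]? }
¬¬-decidable (suc n) P ¬dec =
  ¬¬-decidable n (P ∘ (outside ∷_)) λ dec₀ →
  ¬¬-decidable n (P ∘ (inside ∷_)) λ dec₁ →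
  ¬dec λ { (outside ∷ S) → dec₀ S ; (inside ∷ S) → dec₁ S }

≤-byDecidability : ∀ (P : Pred (Subset n) 0ℓ) {a b : ℚ} → (Decidable P → a ≤ℚ b) → a ≤ℚ b
≤-byDecidability {n} P f = decidable-stable (_ ≤? _) λ a≰b → ¬¬-decidable n P (a≰b ∘ f)

+-squeeze : ∀ {a b c d : ℚ} → a ≤ℚ b → c ≤ℚ d → b + d ≤ℚ a + c → a ≡ b × c ≡ d
+-squeeze a≤b c≤d b+d≤a+c =
  ≤-antisym a≤b (≮⇒≥ λ a<b → <-irrefl refl (≤-<-trans b+d≤a+c (+-mono-<-≤ a<b c≤d))) ,
  ≤-antisym c≤d (≮⇒≥ λ c<d → <-irrefl refl (≤-<-trans b+d≤a+c (+-mono-≤-< a≤b c<d)))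

≤∧≢⇒< : ∀ {a b : ℚ} → a ≤ℚ b → a ≢ b → a <ℚ b
≤∧≢⇒< a≤b a≢b = ≰⇒> λ b≤a → a≢b (≤-antisym a≤b b≤a)

sumFin-cong : {f g : Fin n → ℚ} → (∀ i → f i ≡ g i) → sumFin f ≡ sumFin g
sumFin-cong {zero} _ = refl
sumFin-cong {suc n} f≗g = cong₂ _+_ (f≗g zero) (sumFin-cong (f≗g ∘ suc))

sumFin-mono-≤ : {f g : Fin n → ℚ} → (∀ i → f i ≤ℚ g i) → sumFin f ≤ℚ sumFin g
sumFin-mono-≤ {zero} _ = ≤-refl
sumFin-mono-≤ {suc n} f≤g = +-mono-≤ (f≤g zero) (sumFin-mono-≤ (f≤g ∘ suc))

sumFin-mono-< : {f g : Fin n → ℚ} → (∀ i → f i ≤ℚ g i) → ∀ i → f i <ℚ g i → sumFin f <ℚ sumFin g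
sumFin-mono-< {suc n} f≤g zero fi<gi = +-mono-<-≤ fi<gi (sumFin-mono-≤ (f≤g ∘ suc))
sumFin-mono-< {suc n} f≤g (suc i) fi<gi = +-mono-≤-< (f≤g zero) (sumFin-mono-< (f≤g ∘ suc) i fi<gi)

sumFin-zero : sumFin {n} (const 0ℚ) ≡ 0ℚ
sumFin-zero {zero} = refl
sumFin-zero {suc n} = trans (cong (0ℚ +_) (sumFin-zero {n})) (+-identityʳ 0ℚ)

sumFin-*ˡ : ∀ c (f : Fin n → ℚ) → sumFin (λ i → c * f i) ≡ c * sumFin f
sumFin-*ˡ {zero} c f = sym (*-zeroʳ c)
sumFin-*ˡ {suc n} c f =
  trans (cong (c * f zero +_) (sumFin-*ˡ c (f ∘ suc))) (sym (*-distribˡ-+ c _ _))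

sumFin-+ : ∀ (f g : Fin n → ℚ) → sumFin (λ i → f i + g i) ≡ sumFin f + sumFin g
sumFin-+ {zero} f g = sym (+-identityʳ 0ℚ)
sumFin-+ {suc n} f g =
  trans (cong (f zero + g zero +_) (sumFin-+ (f ∘ suc) (g ∘ suc)))
        (interchange (f zero) (g zero) _ _)

dot-⊕ : ∀ (w x y : Point n) → dot w (x ⊕ y) ≡ dot w x + dot w y
dot-⊕ w x y = trans (sumFin-cong λ i → *-distribˡ-+ (w i) (x i) (y i))
                    (sumFin-+ (λ i → w i * x i) (λ i → w i * y i))

dot-zeroP : ∀ (w : Point n) → dot w zeroP ≡ 0ℚ
dot-zeroP {n} w = trans (sumFin-cong (*-zeroʳ ∘ w)) (sumFin-zero {n})

unit : Fin n → Point n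
unit zero zero = 1ℚ
unit zero (suc i) = 0ℚ
unit (suc t) zero = 0ℚ
unit (suc t) (suc i) = unit t i

dot-unit : ∀ (w : Point n) t → dot w (unit t) ≡ w t
dot-unit {suc n} w zero =
  trans (cong₂ _+_ (*-identityʳ (w zero)) (dot-zeroP (w ∘ suc))) (+-identityʳ (w zero))
dot-unit {suc n} w (suc t) =
  trans (cong₂ _+_ (*-zeroʳ (w zero)) (dot-unit (w ∘ suc) t)) (+-identityˡ _)

unit-nonneg : ∀ (t i : Fin n) → 0ℚ ≤ℚ unit t i
unit-nonneg zero zero = nonNegative⁻¹ 1ℚ
unit-nonneg zero (suc i) = ≤-refl
unit-nonneg (suc t) zero = ≤-refl
unit-nonneg (suc t) (suc i) = unit-nonneg t i

unit-off : ∀ {t i : Fin n} → i ≢ t → unit t i ≡ 0ℚ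
unit-off {t = zero} {zero} i≢t = ⊥-elim (i≢t refl)
unit-off {t = zero} {suc i} _ = refl
unit-off {t = suc t} {zero} _ = refl
unit-off {t = suc t} {suc i} i≢t = unit-off (i≢t ∘ cong suc)

Δ-unit : t ∈ S → Δ S (unit t)
Δ-unit {t = t} {S} t∈S =
  unit-nonneg t ,
  (λ i i∉S → unit-off λ i≡t → i∉S (subst (_∈ S) (sym i≡t) t∈S)) ,
  trans (sym (sumFin-cong (*-identityˡ ∘ unit t))) (dot-unit (const 1ℚ) t)

Δ-support⊆ : Δ S p → ∀ i → p i ≢ 0ℚ → i ∈ S
Δ-support⊆ {S = S} (_ , p-off , _) i pi≢0 with i ∈? S
... | yes i∈S = i∈S
... | no i∉S = ⊥-elim (pi≢0 (p-off i i∉S))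

Δ-weighted-const : ∀ c → Δ S p → sumFin (λ i → c * p i) ≡ c
Δ-weighted-const {p = p} c (_ , _ , Σp≡1) =
  trans (sumFin-*ˡ c p) (trans (cong (c *_) Σp≡1) (*-identityʳ c))

IsArgmax : Point n → Subset n → Fin n → Set
IsArgmax w S t = t ∈ S × (∀ s → s ∈ S → w s ≤ℚ w t)

argmax : ∀ (w : Point n) S → Nonempty S → ∃ (IsArgmax w S)
argmax {suc n} w (b ∷ S) S≠∅ with nonempty? S
argmax {suc n} w (b ∷ S) (zero , here) | no S=∅ =
  zero , here , λ { zero here → ≤-refl ; (suc s) (there s∈S) → ⊥-elim (S=∅ (s , s∈S)) }
argmax {suc n} w (b ∷ S) (suc s , there s∈S) | no S=∅ = ⊥-elim (S=∅ (s , s∈S))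
argmax {suc n} w (b ∷ S) _ | yes S≠∅ with argmax (w ∘ suc) S S≠∅
... | t , t∈S , t-max with b | w (suc t) ≤? w zero
... | outside | _ = suc t , there t∈S , λ { (suc s) (there s∈S) → t-max s s∈S }
... | inside | yes wt≤w0 =
  zero , here , λ { zero here → ≤-refl ; (suc s) (there s∈S) → ≤-trans (t-max s s∈S) wt≤w0 }
... | inside | no wt≰w0 =
  suc t , there t∈S , λ { zero here → <⇒≤ (≰⇒> wt≰w0) ; (suc s) (there s∈S) → t-max s s∈S }

Δ-term≤ : Δ S p → IsArgmax w S t → ∀ i → w i * p i ≤ℚ w t * p i
Δ-term≤ {S = S} {p} {w} {t} (p≥0 , p-off , _) (_ , t-max) i with i ∈? S
... | yes i∈S = *-monoʳ-≤-nonNeg (p i) {{nonNegative (p≥0 i)}} (t-max i i∈S)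
... | no i∉S rewrite p-off i i∉S = ≤-reflexive (trans (*-zeroʳ (w i)) (sym (*-zeroʳ (w t))))

Δ-dot≤ : Δ S p → IsArgmax w S t → dot w p ≤ℚ w t
Δ-dot≤ p∈Δ t-max =
  ≤-trans (sumFin-mono-≤ (Δ-term≤ p∈Δ t-max)) (≤-reflexive (Δ-weighted-const _ p∈Δ))

Δ-dot< : Δ S p → IsArgmax w S t → ∀ i → p i ≢ 0ℚ → w i <ℚ w t → dot w p <ℚ w t
Δ-dot< {p = p} p∈Δ@(p≥0 , _ , _) t-max i pi≢0 wi<wt =
  <-≤-trans (sumFin-mono-< (Δ-term≤ p∈Δ t-max) i (*-monoˡ-<-pos (p i) {{pi>0}} wi<wt))
            (≤-reflexive (Δ-weighted-const _ p∈Δ))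
  where
  pi>0 = positive (≤∧≢⇒< (p≥0 i) (pi≢0 ∘ sym))

Δ-dot≥ : Δ S p → t ∈ S → (∀ i → p i ≢ 0ℚ → IsArgmax w S i) → w t ≤ℚ dot w p
Δ-dot≥ {p = p} {t} {w} p∈Δ@(p≥0 , _ , _) t∈S support-max =
  ≤-trans (≤-reflexive (sym (Δ-weighted-const _ p∈Δ))) (sumFin-mono-≤ term≤)
  where
  term≤ : ∀ i → w t * p i ≤ℚ w i * p i
  term≤ i with p i ≟ 0ℚ
  ... | yes pi≡0 rewrite pi≡0 = ≤-reflexive (trans (*-zeroʳ (w t)) (sym (*-zeroʳ (w i))))
  ... | no pi≢0 = *-monoʳ-≤-nonNeg (p i) {{nonNegative (p≥0 i)}} (proj₂ (support-max i pi≢0) t t∈S)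

argmax⇒face : IsArgmax w S t → face (Δ S) w (unit t)
argmax⇒face {w = w} {t = t} t-max@(t∈S , _) =
  Δ-unit t∈S , λ q q∈Δ → ≤-trans (Δ-dot≤ q∈Δ t-max) (≤-reflexive (sym (dot-unit w t)))

face⇒support-argmax : face (Δ S) w p → ∀ i → p i ≢ 0ℚ → IsArgmax w S i
face⇒support-argmax {S = S} {w} {p} (p∈Δ , p-max) i pi≢0 =
  Δ-support⊆ p∈Δ i pi≢0 , λ s s∈S →
    let t , t-max = argmax w S (s , s∈S)
        wt≤p = subst (_≤ℚ dot w p) (dot-unit w t) (p-max (unit t) (Δ-unit (proj₁ t-max)))
    in ≤-trans (proj₂ t-max s s∈S)
               (≮⇒≥ λ wi<wt → <-irrefl refl (<-≤-trans (Δ-dot< p∈Δ t-max i pi≢0 wi<wt) wt≤p))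

support-argmax⇒face : Δ S p → Nonempty S → (∀ i → p i ≢ 0ℚ → IsArgmax w S i) → face (Δ S) w p
support-argmax⇒face {S = S} {w = w} p∈Δ S≠∅ support-max =
  p∈Δ , λ q q∈Δ →
    let t , t-max = argmax w S S≠∅
    in ≤-trans (Δ-dot≤ q∈Δ t-max) (Δ-dot≥ p∈Δ (proj₁ t-max) support-max)

sumOver : ∀ {A : Set} → (A → ℚ) → List A → ℚ
sumOver f [] = 0ℚ
sumOver f (a ∷ as) = f a + sumOver f as

sumOver-mono : ∀ {A : Set} {f g : A → ℚ} → (∀ a → f a ≤ℚ g a) → ∀ as → sumOver f as ≤ℚ sumOver g as
sumOver-mono f≤g [] = ≤-refl
sumOver-mono f≤g (a ∷ as) = +-mono-≤ (f≤g a) (sumOver-mono f≤g as)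

sumOver-squeeze : ∀ {A : Set} {f g : A → ℚ} → (∀ a → f a ≤ℚ g a) →
                  ∀ as → sumOver g as ≤ℚ sumOver f as → ∀ {a} → a ∈ₗ as → f a ≡ g a
sumOver-squeeze f≤g (a ∷ as) g≤f (here refl) =
  proj₁ (+-squeeze (f≤g a) (sumOver-mono f≤g as) g≤f)
sumOver-squeeze f≤g (b ∷ as) g≤f (there a∈as) =
  sumOver-squeeze f≤g as
    (≤-reflexive (sym (proj₂ (+-squeeze (f≤g b) (sumOver-mono f≤g as) g≤f)))) a∈as

dot-sumPoints : ∀ (w : Point n) (p : Subset n → Point n) Ss →
                dot w (sumPoints (map p Ss)) ≡ sumOver (λ S → dot w (p S)) Ss
dot-sumPoints w p [] = dot-zeroP w
dot-sumPoints w p (S ∷ Ss) = trans (dot-⊕ w (p S) _) (cong (dot w (p S) +_) (dot-sumPoints w p Ss))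

∈-allSubsets : ∀ (S : Subset n) → S ∈ₗ allSubsets n
∈-allSubsets [] = here refl
∈-allSubsets {suc n} (outside ∷ S) = ∈-++⁺ˡ (∈-map⁺ (outside ∷_) (∈-allSubsets S))
∈-allSubsets {suc n} (inside ∷ S) =
  ∈-++⁺ʳ (map (outside ∷_) (allSubsets n)) (∈-map⁺ (inside ∷_) (∈-allSubsets S))

minkowskiPoint : (Subset n → Point n) → Point n
minkowskiPoint {n} p = sumPoints (map p (allSubsets n))

dot-minkowski : ∀ (w : Point n) (p : Subset n → Point n) → (∀ i → x i ≡ minkowskiPoint p i) →
                dot w x ≡ sumOver (λ S → dot w (p S)) (allSubsets n)
dot-minkowski {n} w p x≗p =
  trans (sumFin-cong λ i → cong (w i *_) (x≗p i)) (dot-sumPoints w p (allSubsets n))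

module _ (Γ : SimpleGraph n) (j : ℕ) where

  summand-dot≤ : ∀ w (qx : Q Γ j x) (qy : Q Γ j y) →
                 (∀ S → Contributes Γ j S → face (Δ S) w (proj₁ qy S)) →
                 ∀ S → dot w (proj₁ qx S) ≤ℚ dot w (proj₁ qy S)
  summand-dot≤ w (p , p∈Δ , p-off , _) (q , _ , q-off , _) q-max S = ≤-byCases λ where
    (yes c) → proj₂ (q-max S c) (p S) (p∈Δ S c)
    (no ¬c) → ≤-reflexive (cong (dot w) (trans (p-off S ¬c) (sym (q-off S ¬c))))

  Q-face⁺ : ∀ w (qx : Q Γ j x) → (∀ S → Contributes Γ j S → face (Δ S) w (proj₁ qx S)) →
            face (Q Γ j) w x
  Q-face⁺ w qx@(p , _ , _ , x≗p) p-max =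
    qx , λ { y qy@(q , _ , _ , y≗q) →
      subst₂ _≤ℚ_ (sym (dot-minkowski w q y≗q)) (sym (dot-minkowski w p x≗p))
        (sumOver-mono (summand-dot≤ w qy qx p-max) (allSubsets n)) }

  module _ (dec : Decidable (Contributes Γ j)) where

    select : (∀ S → Contributes Γ j S → Point n) → Subset n → Point n
    select f S with dec S
    ... | yes c = f S c
    ... | no _ = zeroP

    select-contributing : ∀ f S → Contributes Γ j S → ∃[ c ] select f S ≡ f S c
    select-contributing f S c with dec S
    ... | yes c′ = c′ , refl
    ... | no ¬c = ⊥-elim (¬c c)

    select-∈Q : ∀ f → (∀ S c → Δ S (f S c)) → Q Γ j (minkowskiPoint (select f))
    select-∈Q f f∈Δ = select f , ∈Δ , off , λ _ → refl
      where
      ∈Δ : ∀ S → Contributes Γ j S → Δ S (select f S)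
      ∈Δ S c with dec S
      ... | yes c′ = f∈Δ S c′
      ... | no ¬c = ⊥-elim (¬c c)
      off : ∀ S → ¬ Contributes Γ j S → select f S ≡ zeroP
      off S ¬c with dec S
      ... | yes c = ⊥-elim (¬c c)
      ... | no _ = refl

    vertexSummands : (∀ S → Contributes Γ j S → Fin n) → Subset n → Point n
    vertexSummands g = select λ S c → unit (g S c)

    module _ {w : Point n} (g : ∀ S → Contributes Γ j S → Fin n)
             (g-max : ∀ S c → IsArgmax w S (g S c)) where

      vertexPoint-∈Q : Q Γ j (minkowskiPoint (vertexSummands g))
      vertexPoint-∈Q = select-∈Q _ λ S c → Δ-unit (proj₁ (g-max S c))

      vertexSummand-face : ∀ S → Contributes Γ j S → face (Δ S) w (vertexSummands g S)
      vertexSummand-face S c with select-contributing (λ S c → unit (g S c)) S c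
      ... | c′ , eq rewrite eq = argmax⇒face (g-max S c′)

      vertexPoint-face : face (Q Γ j) w (minkowskiPoint (vertexSummands g))
      vertexPoint-face = Q-face⁺ w vertexPoint-∈Q vertexSummand-face

  argmaxVertex : Point n → ∀ S → Contributes Γ j S → Fin n
  argmaxVertex w S (_ , S≠∅ , _) = proj₁ (argmax w S S≠∅)

  argmaxVertex-argmax : ∀ w S c → IsArgmax w S (argmaxVertex w S c)
  argmaxVertex-argmax w S (_ , S≠∅ , _) = proj₂ (argmax w S S≠∅)

  -- Compare x with the vertex o built from w-maximal vertices: summandwise x ≤ o, but
  -- in total o ≤ x, so every summand of x is w-maximal as well.
  Q-face⁻ : ∀ w (qx : Q Γ j x) → face (Q Γ j) w x →
            ∀ S → Contributes Γ j S → face (Δ S) w (proj₁ qx S)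
  Q-face⁻ w qx@(p , p∈Δ , _ , x≗p) (_ , x-max) S c =
    p∈Δ S c , λ q q∈Δ → ≤-byDecidability (Contributes Γ j) λ dec →
      let g = argmaxVertex w
          g-max = argmaxVertex-argmax w
          qo@(o , _) = vertexPoint-∈Q dec g g-max
          o-max = vertexSummand-face dec g g-max
          Σo≤Σp = subst₂ _≤ℚ_ (dot-sumPoints w o (allSubsets n)) (dot-minkowski w p x≗p)
                    (x-max _ qo)
          pS≡oS = sumOver-squeeze (summand-dot≤ w qx qo o-max) (allSubsets n) Σo≤Σp
                    (∈-allSubsets S)
      in ≤-trans (proj₂ (o-max S c) q q∈Δ) (≤-reflexive (sym pS≡oS))

  module _ {w : Point n} {S : Subset n} {t : Fin n} (t-max : IsArgmax w S t) where

    pinnedVertex : ∀ S′ → Contributes Γ j S′ → Fin n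
    pinnedVertex S′ c with ≡-dec Bool._≟_ S′ S
    ... | yes _ = t
    ... | no _ = argmaxVertex w S′ c

    pinnedVertex-argmax : ∀ S′ c → IsArgmax w S′ (pinnedVertex S′ c)
    pinnedVertex-argmax S′ c with ≡-dec Bool._≟_ S′ S
    ... | yes refl = t-max
    ... | no _ = argmaxVertex-argmax w S′ c

    pinnedVertex-at : ∀ c → pinnedVertex S c ≡ t
    pinnedVertex-at c with ≡-dec Bool._≟_ S S
    ... | yes _ = refl
    ... | no S≢S = ⊥-elim (S≢S refl)

ArgmaxInclusion : SimpleGraph n → ℕ → Point n → Point n → Set
ArgmaxInclusion Γ j w u = ∀ S → Contributes Γ j S → ∀ t → IsArgmax w S t → IsArgmax u S t

normalCone⇔argmaxInclusion : ∀ (Γ : SimpleGraph n) j w u →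
                             NormalCone (Q Γ j) w u ⇔ ArgmaxInclusion Γ j w u
normalCone⇔argmaxInclusion Γ j w u = mk⇔ to from
  where
  to : NormalCone (Q Γ j) w u → ArgmaxInclusion Γ j w u
  to nc S c t t-max@(t∈S , _) = t∈S , λ s s∈S → ≤-byDecidability (Contributes Γ j) λ dec →
    let g = pinnedVertex Γ j t-max
        g-max = pinnedVertex-argmax Γ j t-max
        fu = nc _ (vertexPoint-face Γ j dec g g-max)
        qv = vertexPoint-∈Q Γ j dec g g-max
        c′ , eq = select-contributing Γ j dec (λ S c → unit (g S c)) S c
        unit-t-max : face (Δ S) u (unit t)
        unit-t-max = subst (face (Δ S) u) (trans eq (cong unit (pinnedVertex-at Γ j t-max c′)))
                       (Q-face⁻ Γ j u qv fu S c)
    in subst₂ _≤ℚ_ (dot-unit u s) (dot-unit u t) (proj₂ unit-t-max (unit s) (Δ-unit s∈S))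

  from : ArgmaxInclusion Γ j w u → NormalCone (Q Γ j) w u
  from incl x fx@((_ , p∈Δ , _) , _) = Q-face⁺ Γ j u (proj₁ fx) λ { S c@(_ , S≠∅ , _) →
    support-argmax⇒face (p∈Δ S c) S≠∅ λ i pi≢0 →
      incl S c i (face⇒support-argmax (Q-face⁻ Γ j w (proj₁ fx) fx S c) i pi≢0) }

sameNormalCones⇒normallyEquivalent : {P P′ : Polytope n} →
  (∀ w u → NormalCone P w u ⇔ NormalCone P′ w u) → NormallyEquivalent P P′
sameNormalCones⇒normallyEquivalent P≡P′ =
  (λ w → w , λ u → Equivalence.to (P≡P′ w u) , Equivalence.from (P≡P′ w u)) ,
  (λ w → w , λ u → Equivalence.from (P≡P′ w u) , Equivalence.to (P≡P′ w u))

module _ {Γ : SimpleGraph n} {U : Subset n} where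

  reach-start∈ : ∀ {a b} → ReachIn Γ U a b → a ∈ U
  reach-start∈ (here a∈U) = a∈U
  reach-start∈ (step a∈U _ _) = a∈U

  reach-trans : ∀ {a b c} → ReachIn Γ U a b → ReachIn Γ U b c → ReachIn Γ U a c
  reach-trans (here _) b⇝c = b⇝c
  reach-trans (step a∈U a~k k⇝b) b⇝c = step a∈U a~k (reach-trans k⇝b b⇝c)

  reach-sym : ∀ {a b} → ReachIn Γ U a b → ReachIn Γ U b a
  reach-sym (here a∈U) = here a∈U
  reach-sym {a} (step {k = k} a∈U a~k k⇝b) =
    reach-trans (reach-sym k⇝b) (step (reach-start∈ k⇝b) (trans (symm Γ k a) a~k) (here a∈U))

data Last {A : Set} : List A → A → Set where
  last-single : ∀ {a} → Last (a ∷ []) a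
  last-cons : ∀ {a b as} → Last as b → Last (a ∷ as) b

Last⇒∈ : ∀ {A : Set} {as : List A} {b} → Last as b → b ∈ₗ as
Last⇒∈ last-single = here refl
Last⇒∈ (last-cons last) = there (Last⇒∈ last)

vertexSet : List (Fin n) → Subset n
vertexSet [] = ∅
vertexSet (v ∷ vs) = ⁅ v ⁆ ∪ vertexSet vs

∈-vertexSet⁺ : ∀ {v : Fin n} {vs} → v ∈ₗ vs → v ∈ vertexSet vs
∈-vertexSet⁺ {vs = v ∷ vs} (here refl) = x∈p∪q⁺ (inj₁ (x∈⁅x⁆ v))
∈-vertexSet⁺ {vs = v ∷ vs} (there v∈vs) = x∈p∪q⁺ (inj₂ (∈-vertexSet⁺ v∈vs))

∈-vertexSet⁻ : ∀ {v : Fin n} {vs} → v ∈ vertexSet vs → v ∈ₗ vs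
∈-vertexSet⁻ {vs = []} v∈∅ = ⊥-elim (∉⊥ v∈∅)
∈-vertexSet⁻ {vs = u ∷ vs} v∈ with x∈p∪q⁻ ⁅ u ⁆ (vertexSet vs) v∈
... | inj₁ v∈⁅u⁆ = here (x∈⁅y⁆⇒x≡y u v∈⁅u⁆)
... | inj₂ v∈vs = there (∈-vertexSet⁻ v∈vs)

∣⁅x⁆∪p∣≡1+∣p∣ : ∀ (x : Fin n) p → x ∉ p → ∣ ⁅ x ⁆ ∪ p ∣ ≡ suc ∣ p ∣
∣⁅x⁆∪p∣≡1+∣p∣ zero (outside ∷ p) _ = cong (suc ∘ ∣_∣) (∪-identityˡ p)
∣⁅x⁆∪p∣≡1+∣p∣ zero (inside ∷ p) 0∉p = ⊥-elim (0∉p here)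
∣⁅x⁆∪p∣≡1+∣p∣ (suc x) (outside ∷ p) x∉p = ∣⁅x⁆∪p∣≡1+∣p∣ x p (x∉p ∘ there)
∣⁅x⁆∪p∣≡1+∣p∣ (suc x) (inside ∷ p) x∉p = cong suc (∣⁅x⁆∪p∣≡1+∣p∣ x p (x∉p ∘ there))

Consecutive : ℕ → ℕ → Set
Consecutive a b = b ≡ suc a ⊎ a ≡ suc b

Consecutive-zero : ∀ b → Consecutive 0 b ⇔ b ≡ 1
Consecutive-zero b = mk⇔ (λ { (inj₁ b≡1) → b≡1 ; (inj₂ ()) }) inj₁

Consecutive-suc : ∀ {a b} → Consecutive (suc a) (suc b) ⇔ Consecutive a b
Consecutive-suc = mk⇔ (Sum.map ℕ.suc-injective ℕ.suc-injective) (Sum.map (cong suc) (cong suc))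

Consecutive-sym : ∀ {a b} → Consecutive a b ⇔ Consecutive b a
Consecutive-sym = mk⇔ swap swap

module InducedPaths {n} (Γ : SimpleGraph n) where
  open import Data.List.Membership.DecPropositional (Data.Fin._≟_ {n}) using ()
    renaming (_∈?_ to _∈ₗ?_)

  data InducedPath : List (Fin n) → Set where
    single : ∀ v → InducedPath (v ∷ [])
    extend : ∀ {v u vs} → InducedPath (u ∷ vs) → v ∉ₗ u ∷ vs → Adj Γ v u →
             All (¬_ ∘ Adj Γ v) vs → InducedPath (v ∷ u ∷ vs)

  InducedPathIn : Subset n → Fin n → Fin n → Set
  InducedPathIn S a b =
    Σ[ vs ∈ List (Fin n) ] InducedPath (a ∷ vs) × Last (a ∷ vs) b × All (_∈ S) (a ∷ vs)

  suffixFrom : ∀ {S a b vs} → a ∈ₗ vs → InducedPath vs → Last vs b → All (_∈ S) vs →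
               InducedPathIn S a b
  suffixFrom {vs = _ ∷ vs} (here refl) path last vs⊆S = vs , path , last , vs⊆S
  suffixFrom {vs = _ ∷ []} (there ()) _ _ _
  suffixFrom {vs = _ ∷ _ ∷ _} (there a∈) (extend path _ _ _) (last-cons last) (_ ∷ vs⊆S) =
    suffixFrom a∈ path last vs⊆S

  -- Attaching a to the last vertex of the path adjacent to it keeps the path induced.
  prependShortcut : ∀ {S a b vs} → a ∈ S → a ∉ₗ vs → Any (Adj Γ a) vs →
                    InducedPath vs → Last vs b → All (_∈ S) vs → InducedPathIn S a b
  prependShortcut {vs = v ∷ []} a∈S a∉ (here a~v) (single _) last vs⊆S =
    v ∷ [] , extend (single v) a∉ a~v [] , last-cons last , a∈S ∷ vs⊆S
  prependShortcut {vs = _ ∷ []} _ _ (there ()) _ _ _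
  prependShortcut {a = a} {vs = v ∷ u ∷ vs} a∈S a∉ a~vs path@(extend path′ _ _ _)
                  (last-cons last) (v∈S ∷ vs⊆S) with any? (λ x → adj Γ a x Bool.≟ true) (u ∷ vs)
  ... | yes a~tail = prependShortcut a∈S (a∉ ∘ there) a~tail path′ last vs⊆S
  ... | no ¬a~tail =
    v ∷ u ∷ vs , extend path a∉ a~v (¬Any⇒All¬ (u ∷ vs) ¬a~tail) ,
    last-cons (last-cons last) , a∈S ∷ v∈S ∷ vs⊆S
    where
    a~v : Adj Γ a v
    a~v = Any.head ¬a~tail a~vs

  walk⇒inducedPath : ∀ {S a b} → ReachIn Γ S a b → InducedPathIn S a b
  walk⇒inducedPath (here a∈S) = [] , single _ , last-single , a∈S ∷ []
  walk⇒inducedPath {a = a} (step {k = k} a∈S a~k walk) with walk⇒inducedPath walk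
  ... | vs , path , last , vs⊆S with a ∈ₗ? (k ∷ vs)
  ...   | yes a∈ = suffixFrom a∈ path last vs⊆S
  ...   | no a∉ = prependShortcut a∈S a∉ (here a~k) path last vs⊆S

  ¬Adj-self : ∀ v → ¬ Adj Γ v v
  ¬Adj-self v v~v with trans (sym (irrefl Γ v)) v~v
  ... | ()

  Adj-sym : ∀ {v u} → Adj Γ v u ⇔ Adj Γ u v
  Adj-sym {v} {u} = mk⇔ (trans (symm Γ u v)) (trans (symm Γ v u))

  ∣vertexSet∣≡length : ∀ {vs} → InducedPath vs → ∣ vertexSet vs ∣ ≡ length vs
  ∣vertexSet∣≡length (single v) = trans (∣⁅x⁆∪p∣≡1+∣p∣ v ∅ ∉⊥) (cong suc (∣⊥∣≡0 n))
  ∣vertexSet∣≡length (extend {v} path v∉ _ _) =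
    trans (∣⁅x⁆∪p∣≡1+∣p∣ v _ (v∉ ∘ ∈-vertexSet⁻)) (cong suc (∣vertexSet∣≡length path))

  lookup-injective : ∀ {vs} → InducedPath vs → ∀ {i k} → lookup vs i ≡ lookup vs k → i ≡ k
  lookup-injective (single _) {zero} {zero} _ = refl
  lookup-injective (extend _ _ _ _) {zero} {zero} _ = refl
  lookup-injective (extend _ v∉ _ _) {zero} {suc k} eq = ⊥-elim (v∉ (subst (_∈ₗ _) (sym eq) (∈-lookup k)))
  lookup-injective (extend _ v∉ _ _) {suc i} {zero} eq = ⊥-elim (v∉ (subst (_∈ₗ _) eq (∈-lookup i)))
  lookup-injective (extend path _ _ _) {suc i} {suc k} eq = cong suc (lookup-injective path eq)

  head-adjacent⇔second : ∀ {v vs} → InducedPath (v ∷ vs) → ∀ k →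
                         Adj Γ v (lookup (v ∷ vs) k) ⇔ toℕ k ≡ 1
  head-adjacent⇔second _ zero = mk⇔ (⊥-elim ∘ ¬Adj-self _) λ ()
  head-adjacent⇔second (single _) (suc ())
  head-adjacent⇔second (extend _ _ v~u _) (suc zero) = mk⇔ (const refl) (const v~u)
  head-adjacent⇔second (extend _ _ _ far) (suc (suc k)) =
    mk⇔ (⊥-elim ∘ All.lookup far (∈-lookup k)) λ ()

  adjacent⇔consecutive : ∀ {vs} → InducedPath vs → ∀ i k →
                         Adj Γ (lookup vs i) (lookup vs k) ⇔ Consecutive (toℕ i) (toℕ k)
  adjacent⇔consecutive {_ ∷ _} path zero k =
    ⇔-sym (Consecutive-zero _) ⇔-∘ head-adjacent⇔second path k
  adjacent⇔consecutive {_ ∷ _} path (suc i) zero =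
    Consecutive-sym ⇔-∘ (⇔-sym (Consecutive-zero _) ⇔-∘ (head-adjacent⇔second path (suc i) ⇔-∘ Adj-sym))
  adjacent⇔consecutive (single _) (suc ()) (suc _)
  adjacent⇔consecutive (extend path _ _ _) (suc i) (suc k) =
    ⇔-sym Consecutive-suc ⇔-∘ adjacent⇔consecutive path i k

  vertexSet-inducesPath : ∀ {vs} → InducedPath vs → InducesPath Γ (vertexSet vs)
  vertexSet-inducesPath {vs} path = f , f-injective , f-surjective , f-∈ , f-adjacent
    where
    |vs| = ∣vertexSet∣≡length path
    f : Fin ∣ vertexSet vs ∣ → Fin n
    f i = lookup vs (cast |vs| i)
    f-injective : ∀ {i k} → f i ≡ f k → i ≡ k
    f-injective {i} {k} eq = toℕ-injective
      (trans (sym (toℕ-cast |vs| i)) (trans (cong toℕ (lookup-injective path eq)) (toℕ-cast |vs| k)))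
    f-surjective : ∀ v → v ∈ vertexSet vs → ∃[ i ] f i ≡ v
    f-surjective v v∈ =
      cast (sym |vs|) (index v∈vs) ,
      trans (cong (lookup vs) (cast-involutive |vs| (sym |vs|) _)) (sym (lookup-index v∈vs))
      where v∈vs = ∈-vertexSet⁻ {vs = vs} v∈
    f-∈ : ∀ i → f i ∈ vertexSet vs
    f-∈ i = ∈-vertexSet⁺ (∈-lookup {xs = vs} (cast |vs| i))
    f-adjacent : ∀ i k → (Adj Γ (f i) (f k) → PathAdj i k) × (PathAdj i k → Adj Γ (f i) (f k))
    f-adjacent i k =
      subst₂ Consecutive (toℕ-cast |vs| i) (toℕ-cast |vs| k) ∘ Equivalence.to adj⇔ ,
      Equivalence.from adj⇔ ∘ subst₂ Consecutive (sym (toℕ-cast |vs| i)) (sym (toℕ-cast |vs| k))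
      where adj⇔ = adjacent⇔consecutive path (cast |vs| i) (cast |vs| k)

  head-reaches : ∀ {T v vs x} → InducedPath (v ∷ vs) → All (_∈ T) (v ∷ vs) → x ∈ₗ v ∷ vs →
                 ReachIn Γ T v x
  head-reaches _ (v∈T ∷ _) (here refl) = here v∈T
  head-reaches (extend path _ v~u _) (v∈T ∷ vs⊆T) (there x∈) = step v∈T v~u (head-reaches path vs⊆T x∈)

  vertexSet-connected : ∀ {v vs} → InducedPath (v ∷ vs) → InducedConnected Γ (vertexSet (v ∷ vs))
  vertexSet-connected {v} {vs} path =
    (v , ∈-vertexSet⁺ {vs = v ∷ vs} (here refl)) ,
    λ a b a∈ b∈ → reach-trans (reach-sym (reaches a∈)) (reaches b∈)
    where
    reaches : ∀ {x} → x ∈ vertexSet (v ∷ vs) → ReachIn Γ (vertexSet (v ∷ vs)) v x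
    reaches = head-reaches path (All.tabulate ∈-vertexSet⁺) ∘ ∈-vertexSet⁻ {vs = v ∷ vs}

  inducedPath-between : ∀ {S a b} → ReachIn Γ S a b →
    Σ[ T ∈ Subset n ] T ⊆ S × a ∈ T × b ∈ T × InducedConnected Γ T × InducesPath Γ T
  inducedPath-between {a = a} walk =
    let vs , path , last , vs⊆S = walk⇒inducedPath walk
    in vertexSet (a ∷ vs) , All.lookup vs⊆S ∘ ∈-vertexSet⁻ , ∈-vertexSet⁺ {vs = a ∷ vs} (here refl) ,
       ∈-vertexSet⁺ (Last⇒∈ last) , vertexSet-connected path , vertexSet-inducesPath path

argmaxInclusion-mono : ∀ {Γ : SimpleGraph n} {j j′} → j ≤ j′ →
                       ArgmaxInclusion Γ j′ w u → ArgmaxInclusion Γ j w u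
argmaxInclusion-mono j≤j′ incl S (|S|≤1+j , S-connected) =
  incl S (ℕ.≤-trans |S|≤1+j (s≤s j≤j′) , S-connected)

argmaxInclusion-saturates : ∀ {Γ : SimpleGraph n} {m j} →
                            (∀ T → InducesPath Γ T → ∣ T ∣ ≤ suc m) →
                            ArgmaxInclusion Γ m w u → ArgmaxInclusion Γ j w u
argmaxInclusion-saturates {Γ = Γ} paths≤ incl S (_ , _ , S-connected) t (t∈S , t-max) =
  t∈S , λ s s∈S →
    let T , T⊆S , t∈T , s∈T , T-connected , T-path =
          InducedPaths.inducedPath-between Γ (S-connected t s t∈S s∈S)
    in proj₂ (incl T (paths≤ T T-path , T-connected) t (t∈T , λ x x∈T → t-max x (T⊆S x∈T))) s s∈T

mainTheorem5 : (n : ℕ) → 0 < n → (Γ : SimpleGraph n) → Connected Γ →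
    (M : Subset n) → InducesPath Γ M →
    (∀ (M' : Subset n) → InducesPath Γ M' → ∣ M' ∣ ≤ ∣ M ∣) →
    ∀ (k : ℕ) → ∣ M ∣ ≤ k →
    NormallyEquivalent (Q Γ k) (Q Γ (∣ M ∣ ∸ 1))
mainTheorem5 n _ Γ _ M _ M-longest k |M|≤k =
  sameNormalCones⇒normallyEquivalent λ w u →
    ⇔-sym (normalCone⇔argmaxInclusion Γ m w u) ⇔-∘
    (mk⇔ (argmaxInclusion-mono m≤k) (argmaxInclusion-saturates paths≤) ⇔-∘
     normalCone⇔argmaxInclusion Γ k w u)
  where
  m = ∣ M ∣ ∸ 1
  m≤k : m ≤ k
  m≤k = ℕ.≤-trans (ℕ.m∸n≤m ∣ M ∣ 1) |M|≤k
  paths≤ : ∀ T → InducesPath Γ T → ∣ T ∣ ≤ suc m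
  paths≤ T T-path = ℕ.≤-trans (M-longest T T-path) (ℕ.m≤n+m∸n ∣ M ∣ 1)
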